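{- Let $G$ be a $3$-colourable graph and let $C_1,C_2,C_3$ be a partition of $V(G)$ into three independent sets. Then every ordering $\phi$ of $V(G)$ of the form $C_1+C_2+C_3$ (all vertices of $C_1$, then all of $C_2$, then all of $C_3$, each set in an arbitrary internal order) contains no disjoint triple.
   Context: All graphs are finite, simple and undirected. For an ordering $\phi$ of $V(G)$ write $a<_\phi b$ if $a$ precedes $b$, and $a\le_\phi b$ if $a=b$ or $a<_\phi b$. Three edges $uv, wx, yz\in E(G)$ form a disjoint triple in $\phi$ if $u<_\phi v\le_\phi w<_\phi x\le_\phi y<_\phi z$. -}

module Defs where

open import Data.Nat using (ℕ)
open import Data.Fin using (Fin; _<_; _≤_)
open import Data.Sum using (_⊎_)
open import Data.Product using (_×_; ∃-syntax)
open import Relation.Nullary using (¬_)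
open import Relation.Binary.PropositionalEquality using (_≡_; _≢_)
open import Function.Bundles using (_↔_)

record Graph (n : ℕ) : Set₁ where
  field
    Adj       : Fin n → Fin n → Set
    Adj-sym   : ∀ {u v} → Adj u v → Adj v u
    Adj-irrefl : ∀ {u} → ¬ Adj u u
open Graph public

-- An ordering φ of V(G): a bijection from vertices to positions 0..n-1.
Ordering : ℕ → Set
Ordering n = Fin n ↔ Fin n

module _ {n : ℕ} (φ : Ordering n) where
  open Function.Bundles.Inverse φ using (to)

  _<φ_ : Fin n → Fin n → Set
  a <φ b = to a < to b

  _≤φ_ : Fin n → Fin n → Set
  a ≤φ b = (a ≡ b) ⊎ (a <φ b)

DisjointTriple : {n : ℕ} → Graph n → Ordering n → Fin n → Fin n → Fin n → Fin n → Fin n → Fin n → Set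
DisjointTriple G φ u v w x y z =
  Adj G u v × Adj G w x × Adj G y z ×
  (_<φ_ φ u v) × (_≤φ_ φ v w) × (_<φ_ φ w x) × (_≤φ_ φ x y) × (_<φ_ φ y z)

ContainsDisjointTriple : {n : ℕ} → Graph n → Ordering n → Set
ContainsDisjointTriple G φ = ∃[ u ] ∃[ v ] ∃[ w ] ∃[ x ] ∃[ y ] ∃[ z ] DisjointTriple G φ u v w x y z

-- A partition of V(G) into three independent sets C₁,C₂,C₃, encoded by the
-- map c sending each vertex to the index of its part (0,1,2 for C₁,C₂,C₃).
IsIndependentPartition3 : {n : ℕ} → Graph n → (Fin n → Fin 3) → Set
IsIndependentPartition3 G c = ∀ {u v} → Adj G u v → c u ≢ c v

IsConcatenationOrdering : {n : ℕ} → (Fin n → Fin 3) → Ordering n → Set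
IsConcatenationOrdering c φ = ∀ u v → c u < c v → _<φ_ φ u v

module Submission where

open import Defs
open import Data.Nat using (ℕ; _+_; z≤n; s≤s)
  renaming (_≤_ to _≤ℕ_; _≤?_ to _≤ℕ?_)
open import Data.Nat.Properties using (≰⇒>; ≤⇒≯; +-monoʳ-≤; module ≤-Reasoning)
open import Data.Fin using (Fin; toℕ; _≤_; _<_)
open import Data.Fin.Properties using (toℕ<n; ≤-refl; <-asym; ≤∧≢⇒<)
open import Data.Sum using (inj₁; inj₂)
open import Data.Product using (_,_)
open import Relation.Nullary using (¬_; yes; no; contradiction)
open import Relation.Binary.PropositionalEquality using (refl; _≢_)

-- Along an ordering of the form C₁ + ⋯ + Cₖ the colour never decreases, and it
-- strictly increases along each edge. A disjoint triple therefore forces three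
-- strict increases of the colour, which is impossible with only three colours.

module ConcatenationOrdering {n k : ℕ} (c : Fin n → Fin k) (φ : Ordering n)
    (concatenation : ∀ u v → c u < c v → _<φ_ φ u v) where

  colour-mono-<φ : ∀ {a b} → _<φ_ φ a b → c a ≤ c b
  colour-mono-<φ {a} {b} a<b with toℕ (c a) ≤ℕ? toℕ (c b)
  ... | yes ca≤cb = ca≤cb
  ... | no  ca≰cb = contradiction (concatenation b a (≰⇒> ca≰cb)) (<-asym a<b)

  colour-mono-≤φ : ∀ {a b} → _≤φ_ φ a b → c a ≤ c b
  colour-mono-≤φ (inj₁ refl) = ≤-refl
  colour-mono-≤φ (inj₂ a<b)  = colour-mono-<φ a<b

  colour-strict-on-edges : (G : Graph n) → (∀ {u v} → Adj G u v → c u ≢ c v) →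
                           ∀ {a b} → Adj G a b → _<φ_ φ a b → c a < c b
  colour-strict-on-edges G independent ab a<b =
    ≤∧≢⇒< (colour-mono-<φ a<b) (independent ab)

mainTheorem11 : (n : ℕ) (G : Graph n) (c : Fin n → Fin 3) (φ : Ordering n) →
    IsIndependentPartition3 G c → IsConcatenationOrdering c φ →
    ¬ ContainsDisjointTriple G φ
mainTheorem11 n G c φ independent concatenation
              (u , v , w , x , y , z , uv , wx , yz , u<v , v≤w , w<x , x≤y , y<z) =
  ≤⇒≯ three≤cz (toℕ<n (c z))
  where
    open ConcatenationOrdering c φ concatenation
    rises : ∀ {a b} → Adj G a b → _<φ_ φ a b → c a < c b
    rises = colour-strict-on-edges G independent

    three≤cz : 3 ≤ℕ toℕ (c z)
    three≤cz = begin
      3               ≤⟨ s≤s (s≤s (s≤s z≤n)) ⟩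
      3 + toℕ (c u)   ≤⟨ +-monoʳ-≤ 2 (rises uv u<v) ⟩
      2 + toℕ (c v)   ≤⟨ +-monoʳ-≤ 2 (colour-mono-≤φ v≤w) ⟩
      2 + toℕ (c w)   ≤⟨ +-monoʳ-≤ 1 (rises wx w<x) ⟩
      1 + toℕ (c x)   ≤⟨ +-monoʳ-≤ 1 (colour-mono-≤φ x≤y) ⟩
      1 + toℕ (c y)   ≤⟨ rises yz y<z ⟩
      toℕ (c z)       ∎
      where open ≤-Reasoning
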